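{- Let $G$ be a graph and let $S\subseteq V(G)$ with $|S|=t$. Suppose there are components $C_1,\dots,C_l$ of $G-S$ such that each $C_i$ has a neighbor of every vertex of $S$, and for any two vertices $u,v\in S$ there is a path of odd length between $u$ and $v$ in the subgraph of $G$ induced by $V(C_i)\cup\{u,v\}$. If $l\ge t^2/2$, then $G$ contains an odd $K_t$-minor.
   Context: A graph contains an odd $K_t$-minor if there are $t$ vertex-disjoint trees in it such that every two are joined by an edge, and the vertices of the trees can be 2-colored so that edges inside trees are bichromatic and the chosen edges between trees are monochromatic. -}

module Defs where

open import Data.Nat using (ℕ; zero; suc; _+_; _*_; _≤_)
open import Data.Sum using (_⊎_)
open import Data.Fin using (Fin)
open import Data.Bool using (Bool; true; false; T; not)
open import Data.List using (List; []; _∷_)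
open import Data.List.Relation.Unary.Unique.Propositional using (Unique)
open import Data.Product using (Σ; ∃; ∃-syntax; _×_; _,_)
open import Relation.Binary.PropositionalEquality using (_≡_; _≢_)
open import Relation.Nullary using (¬_)
open import Data.Empty using (⊥)

record Graph : Set where
  field
    n     : ℕ
    adj   : Fin n → Fin n → Bool
    sym   : ∀ x y → adj x y ≡ adj y x
    irrfl : ∀ x → adj x x ≡ false

open Graph public

V : Graph → Set
V G = Fin (n G)

VSet : Graph → Set
VSet G = V G → Bool

_∈_ : ∀ {A : Set} → A → (A → Bool) → Set
x ∈ X = T (X x)

_∉_ : ∀ {A : Set} → A → (A → Bool) → Set
x ∉ X = ¬ (x ∈ X)

Adj : (G : Graph) → V G → V G → Set
Adj G x y = T (adj G x y)

count : ∀ {m} → (Fin m → Bool) → ℕ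
count {zero} P = 0
count {suc m} P with P Fin.zero
... | true  = suc (count (λ i → P (Fin.suc i)))
... | false = count (λ i → P (Fin.suc i))

data Walk {A : Set} (R : A → A → Set) : A → A → Set where
  []  : ∀ {x} → Walk R x x
  _∷_ : ∀ {x y z} → R x y → Walk R y z → Walk R x z

verts : ∀ {A R} {x y : A} → Walk R x y → List A
verts {x = x} []      = x ∷ []
verts {x = x} (_ ∷ w) = x ∷ verts w

len : ∀ {A R} {x y : A} → Walk R x y → ℕ
len []      = 0
len (_ ∷ w) = suc (len w)

IsPath : ∀ {A R} {x y : A} → Walk R x y → Set
IsPath w = Unique (verts w)

AdjIn : (G : Graph) → VSet G → V G → V G → Set
AdjIn G X x y = x ∈ X × y ∈ X × Adj G x y

-- C is a connected component of G - S: nonempty, contained in V(G) ∖ S,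
-- connected in G - S, and maximal (closed under adjacency in G - S).
IsComponentOfMinus : (G : Graph) → (S C : VSet G) → Set
IsComponentOfMinus G S C =
  (∃[ x ] x ∈ C)
  × (∀ x → x ∈ C → x ∉ S)
  × (∀ x y → x ∈ C → y ∈ C → Walk (AdjIn G C) x y)
  × (∀ x y → x ∈ C → y ∉ S → Adj G x y → y ∈ C)

Odd : ℕ → Set
Odd m = ∃[ k ] m ≡ suc (2 * k)

AdjInPlus : (G : Graph) → VSet G → V G → V G → V G → V G → Set
AdjInPlus G C u v x y = InP x × InP y × Adj G x y
  where
  InP : V G → Set
  InP z = z ∈ C ⊎ z ≡ u ⊎ z ≡ v

OddPathVia : (G : Graph) → VSet G → V G → V G → Set
OddPathVia G C u v = Σ (Walk (AdjInPlus G C u v) u v) λ w → IsPath w × Odd (len w)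

record Tree (G : Graph) : Set where
  field
    X        : VSet G
    F        : V G → V G → Bool
    F-sym    : ∀ x y → F x y ≡ F y x
    F-edge   : ∀ x y → T (F x y) → Adj G x y
    F-in     : ∀ x y → T (F x y) → x ∈ X × y ∈ X
    nonempty : ∃[ x ] x ∈ X
    conn     : ∀ x y → x ∈ X → y ∈ X → Walk (λ a b → T (F a b)) x y
    -- no cycle: no tree edge x–y together with a tree path y → x of length ≥ 2
    acyclic  : ∀ x y → T (F x y) → (w : Walk (λ a b → T (F a b)) y x) →
               IsPath w → 2 ≤ len w → ⊥

record OddKMinor (G : Graph) (t : ℕ) : Set where
  field
    tree       : Fin t → Tree G
    colour     : V G → Bool
    disjoint   : ∀ i j → i ≢ j → ∀ x → x ∈ Tree.X (tree i) → x ∉ Tree.X (tree j)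
    bichrom    : ∀ i x y → T (Tree.F (tree i) x y) → colour x ≢ colour y
    joined     : ∀ i j → i ≢ j → ∃[ x ] ∃[ y ]
                   (x ∈ Tree.X (tree i) × y ∈ Tree.X (tree j) × Adj G x y × colour x ≡ colour y)

module Submission where

-- Enumerate S as σ 0, …, σ (t-1). Since t * t ≤ 2 * l there are at least
-- t (t-1) / 2 components, so each pair i < j can be given its own component C(i,j)
-- (via the triangular code j (j-1) / 2 + i), and in it an odd path
-- σ i = a₀, a₁, …, a₂ₖ₊₁ = σ j whose inner vertices lie in C(i,j). The i-th tree
-- consists of σ i together with the halves of all these paths that end at σ i; every
-- vertex other than σ i has a parent (its neighbour toward σ i on its path) of depth
-- one less, which makes the branch a tree. Colouring each vertex by the parity of its
-- depth makes tree edges bichromatic, while the middle edge aₖ aₖ₊₁ of the path of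
-- i < j joins the i-th and j-th trees by two vertices of the same depth k. The trees
-- are disjoint because distinct pairs use disjoint components, which avoid S.

open import Defs
open import Data.Nat using (ℕ; zero; suc; _+_; _*_; _∸_; _≤_; _<_; z≤n; s≤s; s≤s⁻¹; _≤?_; _<?_; pred)
open import Data.Nat.Properties
open import Data.Nat.Tactic.RingSolver using (solve-∀)
open import Data.Fin using (Fin; toℕ; fromℕ<) renaming (_<_ to _<ᶠ_; zero to fzero; suc to fsuc)
open import Data.Fin.Properties using (toℕ-injective; toℕ-fromℕ<; toℕ<n; any?)
  renaming (_≟_ to _≟ᶠ_; <-cmp to <ᶠ-cmp; suc-injective to fsuc-injective)
open import Data.Product using (Σ; ∃; ∃-syntax; _×_; _,_; proj₁; proj₂)
open import Data.Sum using (_⊎_; inj₁; inj₂)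
open import Data.Bool using (Bool; true; false; T; not; _∧_; _∨_)
open import Data.Bool.Properties using (∧-comm; ∨-comm; T-∧; T-∨; not-¬)
open import Data.Unit using (tt)
open import Data.Maybe using (Maybe; just; nothing; maybe′)
open import Data.Maybe.Properties using (just-injective)
open import Data.List using (_∷_; _++_; reverse; [_])
open import Data.List.Properties using (unfold-reverse)
open import Data.List.Relation.Unary.Unique.Propositional using (Unique)
open import Data.List.Relation.Unary.AllPairs using (_∷_)
open import Data.List.Relation.Unary.All using () renaming (lookup to All-lookup)
open import Data.List.Relation.Unary.Any using (here; there)
open import Data.List.Relation.Binary.Permutation.Setoid.Properties using (Unique-resp-↭; ↭-reverse)
open import Data.List.Relation.Binary.Permutation.Setoid using (↭-sym)
open import Data.List.Membership.Propositional using () renaming (_∈_ to _∈ˡ_)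
open import Function.Bundles using (Equivalence)
open import Relation.Binary.PropositionalEquality
  using (_≡_; _≢_; refl; trans; cong; cong₂; subst; setoid; module ≡-Reasoning) renaming (sym to ≡-sym)
open import Relation.Binary.Definitions using (tri<; tri≈; tri>)
open import Relation.Nullary using (¬_; Dec; yes; no)
open import Relation.Nullary.Decidable using (⌊_⌋; toWitness; fromWitness; toWitnessFalse; fromWitnessFalse)
open import Data.Empty using (⊥; ⊥-elim)

_==_ : ∀ {m} → Fin m → Fin m → Bool
x == y = ⌊ x ≟ᶠ y ⌋

adj-sym : (G : Graph) {x y : V G} → Adj G x y → Adj G y x
adj-sym G {x} {y} = subst T (Graph.sym G x y)

module _ {A : Set} {R : A → A → Set} where

  _++ʷ_ : ∀ {x y z} → Walk R x y → Walk R y z → Walk R x z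
  []      ++ʷ v = v
  (e ∷ w) ++ʷ v = e ∷ (w ++ʷ v)

  _∷ʳʷ_ : ∀ {x y z} → Walk R x y → R y z → Walk R x z
  []       ∷ʳʷ e = e ∷ []
  (e′ ∷ w) ∷ʳʷ e = e′ ∷ (w ∷ʳʷ e)

  verts-∷ʳʷ : ∀ {x y z} (w : Walk R x y) (e : R y z) → verts (w ∷ʳʷ e) ≡ verts w ++ [ z ]
  verts-∷ʳʷ []       e = refl
  verts-∷ʳʷ (e′ ∷ w) e = cong (_ ∷_) (verts-∷ʳʷ w e)

  len-∷ʳʷ : ∀ {x y z} (w : Walk R x y) (e : R y z) → len (w ∷ʳʷ e) ≡ suc (len w)
  len-∷ʳʷ []       e = refl
  len-∷ʳʷ (e′ ∷ w) e = cong suc (len-∷ʳʷ w e)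

  first∈verts : ∀ {x y} (w : Walk R x y) → x ∈ˡ verts w
  first∈verts []      = here refl
  first∈verts (e ∷ w) = here refl

  last∈verts : ∀ {x y} (w : Walk R x y) → y ∈ˡ verts w
  last∈verts []      = here refl
  last∈verts (e ∷ w) = there (last∈verts w)

  path-ends-distinct : ∀ {x y} (w : Walk R x y) → IsPath w → 1 ≤ len w → x ≢ y
  path-ends-distinct (e ∷ w) (x∉ ∷ _) _ refl = All-lookup x∉ (last∈verts w) refl

module _ {A : Set} {R : A → A → Set} (R-sym : ∀ {x y} → R x y → R y x) where

  reverseʷ : ∀ {x y} → Walk R x y → Walk R y x
  reverseʷ []      = []
  reverseʷ (e ∷ w) = reverseʷ w ∷ʳʷ R-sym e

  verts-reverseʷ : ∀ {x y} (w : Walk R x y) → verts (reverseʷ w) ≡ reverse (verts w)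
  verts-reverseʷ []          = refl
  verts-reverseʷ {x} (e ∷ w) = trans (verts-∷ʳʷ (reverseʷ w) (R-sym e))
    (trans (cong (_++ [ x ]) (verts-reverseʷ w)) (≡-sym (unfold-reverse x (verts w))))

  len-reverseʷ : ∀ {x y} (w : Walk R x y) → len (reverseʷ w) ≡ len w
  len-reverseʷ []      = refl
  len-reverseʷ (e ∷ w) = trans (len-∷ʳʷ (reverseʷ w) (R-sym e)) (cong suc (len-reverseʷ w))

  reverseʷ-isPath : ∀ {x y} (w : Walk R x y) → IsPath w → IsPath (reverseʷ w)
  reverseʷ-isPath w p = subst Unique (≡-sym (verts-reverseʷ w))
    (Unique-resp-↭ (setoid A) (↭-sym (setoid A) (↭-reverse (setoid A) (verts w))) p)

-- The tree edges are the pairs {x, parent x}; the ranks make the edge set acyclic.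
module ParentTree (G : Graph) (X : VSet G) (r : V G) (parent : V G → V G) (rank : V G → ℕ)
  (r∈X : r ∈ X)
  (parent-step : ∀ x → x ∈ X → x ≢ r →
     parent x ∈ X × Adj G x (parent x) × suc (rank (parent x)) ≡ rank x) where

  module _ (x : V G) (x∈ : x ∈ X) (x≢r : x ≢ r) where
    parent∈X : parent x ∈ X
    parent∈X = proj₁ (parent-step x x∈ x≢r)

    parent-adj : Adj G x (parent x)
    parent-adj = proj₁ (proj₂ (parent-step x x∈ x≢r))

    rank-parent : suc (rank (parent x)) ≡ rank x
    rank-parent = proj₂ (proj₂ (parent-step x x∈ x≢r))

  points : V G → V G → Bool
  points x y = not (x == r) ∧ (parent x == y)

  F : V G → V G → Bool
  F x y = (X x ∧ X y) ∧ (points x y ∨ points y x)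

  Edge : V G → V G → Set
  Edge x y = T (F x y)

  ChildOf : V G → V G → Set
  ChildOf x y = x ∈ X × x ≢ r × parent x ≡ y

  points-sound : ∀ x y → T (points x y) → x ≢ r × parent x ≡ y
  points-sound x y p with Equivalence.to (T-∧ {not (x == r)}) p
  ... | x≢r , px≡y = toWitnessFalse {a? = x ≟ᶠ r} x≢r , toWitness {a? = parent x ≟ᶠ y} px≡y

  edge-cases : ∀ {x y} → Edge x y → ChildOf x y ⊎ ChildOf y x
  edge-cases {x} {y} e with Equivalence.to (T-∧ {X x ∧ X y}) e
  ... | xy∈ , p with Equivalence.to (T-∧ {X x}) xy∈ | Equivalence.to (T-∨ {points x y}) p
  ...   | x∈ , _  | inj₁ q = inj₁ (x∈ , points-sound x y q)
  ...   | _  , y∈ | inj₂ q = inj₂ (y∈ , points-sound y x q)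

  F-sym : ∀ x y → F x y ≡ F y x
  F-sym x y = cong₂ _∧_ (∧-comm (X x) (X y)) (∨-comm (points x y) (points y x))

  Edge-sym : ∀ {x y} → Edge x y → Edge y x
  Edge-sym {x} {y} = subst T (F-sym x y)

  edge-to-parent : ∀ x → x ∈ X → x ≢ r → Edge x (parent x)
  edge-to-parent x x∈ x≢r = Equivalence.from T-∧
    ( Equivalence.from T-∧ (x∈ , parent∈X x x∈ x≢r)
    , Equivalence.from (T-∨ {points x (parent x)})
        (inj₁ (Equivalence.from T-∧ (fromWitnessFalse x≢r , fromWitness {a? = parent x ≟ᶠ parent x} refl))) )

  edge-adj : ∀ x y → Edge x y → Adj G x y
  edge-adj x y e with edge-cases e
  ... | inj₁ (x∈ , x≢r , refl) = parent-adj x x∈ x≢r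
  ... | inj₂ (y∈ , y≢r , refl) = adj-sym G (parent-adj y y∈ y≢r)

  edge-in : ∀ x y → Edge x y → x ∈ X × y ∈ X
  edge-in x y e = Equivalence.to (T-∧ {X x}) (proj₁ (Equivalence.to (T-∧ {X x ∧ X y}) e))

  edge-rank : ∀ {x y} → Edge x y → suc (rank y) ≡ rank x ⊎ suc (rank x) ≡ rank y
  edge-rank e with edge-cases e
  ... | inj₁ (x∈ , x≢r , refl) = inj₁ (rank-parent _ x∈ x≢r)
  ... | inj₂ (y∈ , y≢r , refl) = inj₂ (rank-parent _ y∈ y≢r)

  path-to-root : ∀ m x → rank x ≤ m → x ∈ X → Walk Edge x r
  path-to-root m x rank≤m x∈ with x ≟ᶠ r
  ... | yes refl = []
  path-to-root zero x rank≤0 x∈ | no x≢r =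
    ⊥-elim (1+n≰n (≤-trans (≤-reflexive (rank-parent x x∈ x≢r)) (≤-trans rank≤0 z≤n)))
  path-to-root (suc m) x rank≤m x∈ | no x≢r =
    edge-to-parent x x∈ x≢r ∷ path-to-root m (parent x) rank[parent]≤m (parent∈X x x∈ x≢r)
    where
    rank[parent]≤m : rank (parent x) ≤ m
    rank[parent]≤m = s≤s⁻¹ (subst (_≤ suc m) (≡-sym (rank-parent x x∈ x≢r)) rank≤m)

  connected : ∀ x y → x ∈ X → y ∈ X → Walk Edge x y
  connected x y x∈ y∈ =
    path-to-root _ x ≤-refl x∈ ++ʷ reverseʷ Edge-sym (path-to-root _ y ≤-refl y∈)

  -- On a path that starts at a child c of a and avoids a, every step leads from a
  -- vertex to one of its children, so the rank never decreases.
  rank-ascends : ∀ a c b (w : Walk Edge c b) → Unique (a ∷ verts w) → parent c ≡ a → rank c ≤ rank b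
  rank-ascends a c b []                      _ _ = ≤-refl
  rank-ascends a c b (_∷_ {y = d} e w) (a∉ ∷ u) parent[c]≡a with edge-cases e
  ... | inj₁ (_ , _ , parent[c]≡d) =
    ⊥-elim (All-lookup a∉ (there (first∈verts w)) (trans (≡-sym parent[c]≡a) parent[c]≡d))
  ... | inj₂ (d∈ , d≢r , refl) =
    ≤-trans (≤-trans (n≤1+n (rank c)) (≤-reflexive (rank-parent d d∈ d≢r))) (rank-ascends c d b w u refl)

  no-long-path-to-parent : ∀ c d (w : Walk Edge c d) → IsPath w → 2 ≤ len w →
                           c ∈ X → c ≢ r → parent c ≡ d → ⊥
  no-long-path-to-parent c d (_∷_ {y = e₁} e w) p@(_ ∷ p′) (s≤s 1≤len) c∈ c≢r parent[c]≡d with edge-cases e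
  ... | inj₁ (_ , _ , parent[c]≡e₁) = path-ends-distinct w p′ 1≤len (trans (≡-sym parent[c]≡e₁) parent[c]≡d)
  ... | inj₂ (e₁∈ , e₁≢r , refl) = 1+n≰n (begin
    suc (rank d)          ≡⟨ cong (λ z → suc (rank z)) (≡-sym parent[c]≡d) ⟩
    suc (rank (parent c)) ≡⟨ rank-parent c c∈ c≢r ⟩
    rank c                <⟨ n<1+n (rank c) ⟩
    suc (rank c)          ≡⟨ rank-parent e₁ e₁∈ e₁≢r ⟩
    rank e₁               ≤⟨ rank-ascends c e₁ d w p refl ⟩
    rank d                ∎)
    where open ≤-Reasoning

  -- A cycle would contain an edge from a vertex to its parent and a second, longer
  -- path between the two, which is impossible.
  acyclic : ∀ x y → Edge x y → (w : Walk Edge y x) → IsPath w → 2 ≤ len w → ⊥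
  acyclic x y e w p 2≤len with edge-cases e
  ... | inj₁ (x∈ , x≢r , parent[x]≡y) =
    no-long-path-to-parent x y (reverseʷ Edge-sym w) (reverseʷ-isPath Edge-sym w p)
      (subst (2 ≤_) (≡-sym (len-reverseʷ Edge-sym w)) 2≤len) x∈ x≢r parent[x]≡y
  ... | inj₂ (y∈ , y≢r , parent[y]≡x) = no-long-path-to-parent y x w p 2≤len y∈ y≢r parent[y]≡x

  tree : Tree G
  tree = record
    { X = X ; F = F ; F-sym = F-sym
    ; F-edge = edge-adj ; F-in = edge-in
    ; nonempty = r , r∈X ; conn = connected ; acyclic = acyclic }

record Enumeration {m : ℕ} (c : ℕ) (P : Fin m → Bool) : Set where
  field
    elem     : Fin c → Fin m
    elem∈    : ∀ i → elem i ∈ P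
    elem-inj : ∀ i j → elem i ≡ elem j → i ≡ j

enumerate : ∀ {m} (P : Fin m → Bool) → Enumeration (count P) P
enumerate {zero}  P = record { elem = λ () ; elem∈ = λ () ; elem-inj = λ () }
enumerate {suc m} P with P fzero in P0 | enumerate (λ i → P (fsuc i))
... | true  | rest = record { elem = elem ; elem∈ = elem∈ ; elem-inj = elem-inj }
  where
  module R = Enumeration rest
  elem : Fin (suc (count (λ i → P (fsuc i)))) → Fin (suc m)
  elem fzero    = fzero
  elem (fsuc i) = fsuc (R.elem i)
  elem∈ : ∀ i → elem i ∈ P
  elem∈ fzero    = subst T (≡-sym P0) tt
  elem∈ (fsuc i) = R.elem∈ i
  elem-inj : ∀ i j → elem i ≡ elem j → i ≡ j
  elem-inj fzero    fzero    _  = refl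
  elem-inj (fsuc i) (fsuc j) eq = cong fsuc (R.elem-inj i j (fsuc-injective eq))
... | false | rest = record
  { elem = λ i → fsuc (R.elem i) ; elem∈ = R.elem∈
  ; elem-inj = λ i j eq → R.elem-inj i j (fsuc-injective eq) }
  where module R = Enumeration rest

-- Triangular numbers tri n = 0 + 1 + … + (n-1) = n(n-1)/2. The pair code
-- (i, j) ↦ tri j + i is injective on pairs i < j and, for j < t, lies below tri t.
tri : ℕ → ℕ
tri zero    = 0
tri (suc n) = tri n + n

2*tri+n≡n*n : ∀ n → 2 * tri n + n ≡ n * n
2*tri+n≡n*n zero    = refl
2*tri+n≡n*n (suc n) = begin
  2 * (tri n + n) + suc n     ≡⟨ regroup (tri n) n ⟩
  (2 * tri n + n) + (2 * n + 1) ≡⟨ cong (_+ (2 * n + 1)) (2*tri+n≡n*n n) ⟩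
  n * n + (2 * n + 1)         ≡⟨ square-suc n ⟩
  suc n * suc n               ∎
  where
  open ≡-Reasoning
  regroup : ∀ a n → 2 * (a + n) + suc n ≡ (2 * a + n) + (2 * n + 1)
  regroup = solve-∀
  square-suc : ∀ n → n * n + (2 * n + 1) ≡ suc n * suc n
  square-suc = solve-∀

tri-mono : ∀ {a b} → a ≤ b → tri a ≤ tri b
tri-mono {b = zero}  z≤n = ≤-refl
tri-mono {b = suc b} a≤b with m≤n⇒m<n∨m≡n a≤b
... | inj₁ a<1+b = ≤-trans (tri-mono (s≤s⁻¹ a<1+b)) (m≤m+n (tri b) b)
... | inj₂ refl  = ≤-refl

code-below : ∀ {i j j′} → i < j → j < j′ → tri j + i < tri j′
code-below {i} {j} i<j j<j′ = <-≤-trans (+-monoʳ-< (tri j) i<j) (tri-mono j<j′)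

code-injective : ∀ {i j i′ j′} → i < j → i′ < j′ → tri j + i ≡ tri j′ + i′ → i ≡ i′ × j ≡ j′
code-injective {i} {j} {i′} {j′} i<j i′<j′ eq with <-cmp j j′
... | tri< j<j′ _ _ = ⊥-elim (<-irrefl eq (<-≤-trans (code-below i<j j<j′) (m≤m+n (tri j′) i′)))
... | tri> _ _ j′<j = ⊥-elim (<-irrefl (≡-sym eq) (<-≤-trans (code-below i′<j′ j′<j) (m≤m+n (tri j) i)))
... | tri≈ _ refl _ = +-cancelˡ-≡ (tri j) i i′ eq , refl

tri≤ : ∀ {t l} → t * t ≤ 2 * l → tri t ≤ l
tri≤ {t} {l} t*t≤2l = *-cancelˡ-≤ 2 (≤-trans (m≤m+n (2 * tri t) t) (≤-trans (≤-reflexive (2*tri+n≡n*n t)) t*t≤2l))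

pairCode : ∀ t l → t * t ≤ 2 * l → (i j : Fin t) → i <ᶠ j → Fin l
pairCode t l bound i j i<j = fromℕ< (<-≤-trans (code-below i<j (toℕ<n j)) (tri≤ {t} {l} bound))

pairCode-injective : ∀ t l (bound : t * t ≤ 2 * l) i j i′ j′ h h′ →
                     pairCode t l bound i j h ≡ pairCode t l bound i′ j′ h′ → i ≡ i′ × j ≡ j′
pairCode-injective t l bound i j i′ j′ h h′ eq
  with code-injective h h′ (trans (≡-sym (toℕ-fromℕ< _)) (trans (cong toℕ eq) (toℕ-fromℕ< _)))
... | i≡i′ , j≡j′ = toℕ-injective i≡i′ , toℕ-injective j≡j′

-- The m-th vertex of a walk (its last vertex for m beyond the end).
vertexAt : ∀ {A R} {x y : A} → Walk R x y → ℕ → A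
vertexAt {x = x} []      m       = x
vertexAt {x = x} (e ∷ w) zero    = x
vertexAt         (e ∷ w) (suc m) = vertexAt w m

module _ {A : Set} {R : A → A → Set} where

  vertexAt-last : ∀ {x y} (w : Walk R x y) → vertexAt w (len w) ≡ y
  vertexAt-last []      = refl
  vertexAt-last (e ∷ w) = vertexAt-last w

  vertexAt-first : ∀ {x y} (w : Walk R x y) → vertexAt w 0 ≡ x
  vertexAt-first []      = refl
  vertexAt-first (e ∷ w) = refl

  vertexAt-step : ∀ {x y} (w : Walk R x y) m → m < len w → R (vertexAt w m) (vertexAt w (suc m))
  vertexAt-step (e ∷ w) zero    _         = subst (R _) (≡-sym (vertexAt-first w)) e
  vertexAt-step (e ∷ w) (suc m) (s≤s m<) = vertexAt-step w m m<

  vertexAt∈verts : ∀ {x y} (w : Walk R x y) m → m ≤ len w → vertexAt w m ∈ˡ verts w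
  vertexAt∈verts []      zero    _         = here refl
  vertexAt∈verts (e ∷ w) zero    _         = here refl
  vertexAt∈verts (e ∷ w) (suc m) (s≤s m≤) = there (vertexAt∈verts w m m≤)

  vertexAt-injective : ∀ {x y} (w : Walk R x y) → IsPath w → ∀ m m′ → m ≤ len w → m′ ≤ len w →
                       vertexAt w m ≡ vertexAt w m′ → m ≡ m′
  vertexAt-injective []      _          zero    zero     _         _          _  = refl
  vertexAt-injective (e ∷ w) _          zero    zero     _         _          _  = refl
  vertexAt-injective (e ∷ w) (x∉ ∷ _)  zero    (suc m′) _         (s≤s m′≤) eq =
    ⊥-elim (All-lookup x∉ (vertexAt∈verts w m′ m′≤) eq)
  vertexAt-injective (e ∷ w) (x∉ ∷ _)  (suc m) zero     (s≤s m≤) _          eq =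
    ⊥-elim (All-lookup x∉ (vertexAt∈verts w m m≤) (≡-sym eq))
  vertexAt-injective (e ∷ w) (_ ∷ p)   (suc m) (suc m′) (s≤s m≤) (s≤s m′≤) eq =
    cong suc (vertexAt-injective w p m m′ m≤ m′≤ eq)

-- An odd path u = at 0, at 1, …, at (2k+1) = v in G with distinct vertices whose inner
-- vertices lie in C; the indexed form of OddPathVia G C u v, with k = half.
record IndexedOddPath (G : Graph) (C : VSet G) (u v : V G) : Set where
  field
    half      : ℕ
    at        : ℕ → V G
    at-start  : at 0 ≡ u
    at-end    : at (suc (2 * half)) ≡ v
    adjacent  : ∀ m → m < suc (2 * half) → Adj G (at m) (at (suc m))
    injective : ∀ m m′ → m ≤ suc (2 * half) → m′ ≤ suc (2 * half) → at m ≡ at m′ → m ≡ m′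
    inner∈C   : ∀ m → 1 ≤ m → m ≤ 2 * half → at m ∈ C

index-odd-path : ∀ G C u v → OddPathVia G C u v → IndexedOddPath G C u v
index-odd-path G C u v (w , isPath , k , len≡) = record
  { half = k ; at = vertexAt w ; at-start = vertexAt-first w
  ; at-end = subst (λ z → vertexAt w z ≡ v) len≡ (vertexAt-last w)
  ; adjacent = λ m m< → proj₂ (proj₂ (vertexAt-step w m (≤len m<)))
  ; injective = λ m m′ m≤ m′≤ → vertexAt-injective w isPath m m′ (≤len m≤) (≤len m′≤)
  ; inner∈C = inner∈C }
  where
  ≤len : ∀ {m} → m ≤ suc (2 * k) → m ≤ len w
  ≤len = subst (_ ≤_) (≡-sym len≡)
  -- an inner vertex is neither end (the path is injective), so it lies in C
  inner∈C : ∀ m → 1 ≤ m → m ≤ 2 * k → vertexAt w m ∈ C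
  inner∈C m 1≤m m≤2k with proj₁ (vertexAt-step w m (≤len (s≤s m≤2k)))
  ... | inj₁ ∈C = ∈C
  ... | inj₂ (inj₁ ≡u) with vertexAt-injective w isPath m 0 (≤len (m≤n⇒m≤1+n m≤2k)) z≤n
                             (trans ≡u (≡-sym (vertexAt-first w)))
  ...   | refl = ⊥-elim (1+n≰n 1≤m)
  inner∈C m 1≤m m≤2k | inj₂ (inj₂ ≡v) with vertexAt-injective w isPath m (len w) (≤len (m≤n⇒m≤1+n m≤2k))
                                             ≤-refl (trans ≡v (≡-sym (vertexAt-last w)))
  ... | m≡len = ⊥-elim (1+n≰n (≤-trans (≤-reflexive (≡-sym (trans m≡len len≡))) m≤2k))

-- Positions 0, …, 2k+1 of an odd path fall into two halves: m is in the first half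
-- when m ≤ k. `nearer k m a b` selects a or b according to the half, `depth k m`
-- is the distance from m to the end of its half, and `towardEnd k m` is the
-- neighbouring position one step closer to that end.
nearer : {A : Set} (k m : ℕ) → A → A → A
nearer k m a b with m ≤? k
... | yes _ = a
... | no  _ = b

depth : ℕ → ℕ → ℕ
depth k m with m ≤? k
... | yes _ = m
... | no  _ = suc (2 * k) ∸ m

towardEnd : ℕ → ℕ → ℕ
towardEnd k m with m ≤? k
... | yes _ = pred m
... | no  _ = suc m

2k+1≰k : ∀ k → ¬ suc (2 * k) ≤ k
2k+1≰k k le = 1+n≰n (≤-trans (s≤s (m≤m+n k (k + 0))) le)

module _ {A : Set} (k : ℕ) (a b : A) where

  nearer-start : nearer k 0 a b ≡ a
  nearer-start with 0 ≤? k
  ... | yes _ = refl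
  ... | no 0≰k = ⊥-elim (0≰k z≤n)

  nearer-end : nearer k (suc (2 * k)) a b ≡ b
  nearer-end with suc (2 * k) ≤? k
  ... | yes le = ⊥-elim (2k+1≰k k le)
  ... | no _   = refl

  nearer-middle : nearer k k a b ≡ a × nearer k (suc k) a b ≡ b
  nearer-middle with k ≤? k | suc k ≤? k
  ... | yes _ | no _   = refl , refl
  ... | no k≰k | _     = ⊥-elim (k≰k ≤-refl)
  ... | _      | yes le = ⊥-elim (1+n≰n le)

  nearer-towardEnd : ∀ m → nearer k (towardEnd k m) a b ≡ nearer k m a b
  nearer-towardEnd m with m ≤? k
  nearer-towardEnd m | yes m≤k with pred m ≤? k
  ... | yes _       = refl
  ... | no pred≰k  = ⊥-elim (pred≰k (≤-trans pred[n]≤n m≤k))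
  nearer-towardEnd m | no m≰k with suc m ≤? k
  ... | yes 1+m≤k = ⊥-elim (m≰k (≤-trans (n≤1+n m) 1+m≤k))
  ... | no _      = refl

depth-start : ∀ k → depth k 0 ≡ 0
depth-start k with 0 ≤? k
... | yes _ = refl
... | no 0≰k = ⊥-elim (0≰k z≤n)

depth-end : ∀ k → depth k (suc (2 * k)) ≡ 0
depth-end k with suc (2 * k) ≤? k
... | yes le = ⊥-elim (2k+1≰k k le)
... | no _   = n∸n≡0 (suc (2 * k))

depth-middle : ∀ k → depth k k ≡ k × depth k (suc k) ≡ k
depth-middle k with k ≤? k | suc k ≤? k
... | yes _  | no _   = refl , trans (m+n∸m≡n k (k + 0)) (+-identityʳ k)
... | no k≰k | _      = ⊥-elim (k≰k ≤-refl)
... | _      | yes le = ⊥-elim (1+n≰n le)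

depth-towardEnd : ∀ k m → 1 ≤ m → m ≤ 2 * k → suc (depth k (towardEnd k m)) ≡ depth k m
depth-towardEnd k m 1≤m m≤2k with m ≤? k
depth-towardEnd k (suc m) _ _ | yes 1+m≤k with m ≤? k
... | yes _  = refl
... | no m≰k = ⊥-elim (m≰k (≤-trans (n≤1+n m) 1+m≤k))
depth-towardEnd k m _ m≤2k | no m≰k with suc m ≤? k
... | yes 1+m≤k = ⊥-elim (m≰k (≤-trans (n≤1+n m) 1+m≤k))
... | no _      = ≡-sym (+-∸-assoc 1 m≤2k)

towardEnd-bound : ∀ k m → m ≤ 2 * k → towardEnd k m ≤ suc (2 * k)
towardEnd-bound k m m≤2k with m ≤? k
... | yes _ = ≤-trans pred[n]≤n (m≤n⇒m≤1+n m≤2k)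
... | no _  = s≤s m≤2k

module _ {G : Graph} {C : VSet G} {u v : V G} (P : IndexedOddPath G C u v) where
  open IndexedOddPath P

  adjacent-towardEnd : ∀ m → 1 ≤ m → m ≤ 2 * half → Adj G (at m) (at (towardEnd half m))
  adjacent-towardEnd m 1≤m m≤2k with m ≤? half
  adjacent-towardEnd (suc m) _ m≤2k | yes _ = adj-sym G (adjacent m (m≤n⇒m≤1+n m≤2k))
  ... | no _ = adjacent m (s≤s m≤2k)

Σ<-dec : ∀ {a b} {B : a < b → Set} → (∀ h → Dec (B h)) → Dec (Σ (a < b) B)
Σ<-dec {a} {b} {B} B? with a <? b
... | no a≮b = no (λ (h , _) → a≮b h)
... | yes h with B? h
...   | yes p = yes (h , p)
...   | no ¬p = no (λ (h′ , p) → ¬p (subst B (<-irrelevant h′ h) p))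

isOdd : ℕ → Bool
isOdd zero    = false
isOdd (suc n) = not (isOdd n)

module Construction (G : Graph) (S : VSet G) (t : ℕ)
  (σ : Fin t → V G) (σ∈S : ∀ i → σ i ∈ S) (σ-inj : ∀ i j → σ i ≡ σ j → i ≡ j)
  (l : ℕ) (C : Fin l → VSet G)
  (C-avoids-S : ∀ c x → x ∈ C c → x ∉ S)
  (C-disjoint : ∀ c c′ → c ≢ c′ → ∀ x → x ∈ C c → x ∉ C c′)
  (code : ∀ (i j : Fin t) → i <ᶠ j → Fin l)
  (code-inj : ∀ i j i′ j′ h h′ → code i j h ≡ code i′ j′ h′ → i ≡ i′ × j ≡ j′)
  (path : ∀ i j (h : i <ᶠ j) → IndexedOddPath G (C (code i j h)) (σ i) (σ j)) where

  K : ∀ i j → i <ᶠ j → ℕ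
  K i j h = IndexedOddPath.half (path i j h)

  At : ∀ i j → i <ᶠ j → ℕ → V G
  At i j h = IndexedOddPath.at (path i j h)

  record Location : Set where
    constructor loc
    field
      i j : Fin t
      i<j : i <ᶠ j
      pos : ℕ

  InnerAt : V G → Location → Set
  InnerAt x (loc i j h m) = 1 ≤ m × m ≤ 2 * K i j h × At i j h m ≡ x

  IsInner : V G → Set
  IsInner x = ∃ λ i → ∃ λ j → Σ (i <ᶠ j) λ h → ∃ λ (f : Fin (2 * K i j h)) → At i j h (suc (toℕ f)) ≡ x

  inner? : ∀ x → Dec (IsInner x)
  inner? x = any? λ i → any? λ j → Σ<-dec λ h → any? λ f → At i j h (suc (toℕ f)) ≟ᶠ x

  locate : V G → Maybe Location
  locate x with inner? x
  ... | yes (i , j , h , f , _) = just (loc i j h (suc (toℕ f)))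
  ... | no _ = nothing

  locate-sound : ∀ x L → locate x ≡ just L → InnerAt x L
  locate-sound x L e with inner? x
  locate-sound x _ refl | yes (i , j , h , f , at≡x) = s≤s z≤n , toℕ<n f , at≡x

  InnerAt-∈C : ∀ x i j h m → InnerAt x (loc i j h m) → x ∈ C (code i j h)
  InnerAt-∈C x i j h m (1≤m , m≤2k , refl) = IndexedOddPath.inner∈C (path i j h) m 1≤m m≤2k

  -- Paths of different pairs run through different components, so a vertex
  -- has at most one location.
  InnerAt-unique : ∀ x L L′ → InnerAt x L → InnerAt x L′ → L ≡ L′
  InnerAt-unique x (loc i j h m) (loc i′ j′ h′ m′) p p′ with code i j h ≟ᶠ code i′ j′ h′
  ... | no c≢c′ = ⊥-elim (C-disjoint _ _ c≢c′ x (InnerAt-∈C x i j h m p) (InnerAt-∈C x i′ j′ h′ m′ p′))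
  ... | yes c≡c′ with code-inj i j i′ j′ h h′ c≡c′
  ...   | refl , refl with <-irrelevant h h′
  ...     | refl = cong (loc i j h) (IndexedOddPath.injective (path i j h) m m′
                     (m≤n⇒m≤1+n (proj₁ (proj₂ p))) (m≤n⇒m≤1+n (proj₁ (proj₂ p′)))
                     (trans (proj₂ (proj₂ p)) (≡-sym (proj₂ (proj₂ p′)))))

  locate-complete : ∀ x L → InnerAt x L → ∃ λ L′ → locate x ≡ just L′
  locate-complete x (loc i j h (suc m)) (_ , m<2k , at≡x) with inner? x
  ... | yes _ = _ , refl
  ... | no ¬inner = ⊥-elim (¬inner (i , j , h , fromℕ< m<2k ,
                      subst (λ z → At i j h (suc z) ≡ x) (≡-sym (toℕ-fromℕ< m<2k)) at≡x))

  locate-inner : ∀ x L → InnerAt x L → locate x ≡ just L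
  locate-inner x L p with locate-complete x L p
  ... | L′ , e = trans e (cong just (InnerAt-unique x L′ L (locate-sound x L′ e) p))

  located-∉S : ∀ x L → locate x ≡ just L → x ∉ S
  located-∉S x (loc i j h m) e = C-avoids-S _ x (InnerAt-∈C x i j h m (locate-sound x _ e))

  locate-S : ∀ x → x ∈ S → locate x ≡ nothing
  locate-S x x∈S with locate x in e
  ... | just L  = ⊥-elim (located-∉S x L e x∈S)
  ... | nothing = refl

  owner : Location → Fin t
  owner (loc i j h m) = nearer (K i j h) m i j

  parentAt : Location → V G
  parentAt (loc i j h m) = At i j h (towardEnd (K i j h) m)

  depthAt : Location → ℕ
  depthAt (loc i j h m) = depth (K i j h) m

  -- Vertices on no path interior (in particular the roots) are their own parent, at depth 0.
  parent : V G → V G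
  parent x = maybe′ parentAt x (locate x)

  depthOf : V G → ℕ
  depthOf x = maybe′ depthAt 0 (locate x)

  ownedBy : Maybe Location → Fin t → Bool
  ownedBy nothing  i = false
  ownedBy (just L) i = owner L == i

  branch : Fin t → VSet G
  branch i x = (x == σ i) ∨ ownedBy (locate x) i

  colour : V G → Bool
  colour x = isOdd (depthOf x)

  root∈branch : ∀ i → σ i ∈ branch i
  root∈branch i = Equivalence.from T-∨ (inj₁ (fromWitness {a? = σ i ≟ᶠ σ i} refl))

  located∈branch : ∀ x L → locate x ≡ just L → x ∈ branch (owner L)
  located∈branch x L e = Equivalence.from (T-∨ {x == σ (owner L)})
    (inj₂ (subst (λ M → T (ownedBy M (owner L))) (≡-sym e) (fromWitness {a? = owner L ≟ᶠ owner L} refl)))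

  root-in-branch : ∀ i x → x ≡ σ i → x ∈ branch i × depthOf x ≡ 0
  root-in-branch i _ refl = root∈branch i , cong (maybe′ depthAt 0) (locate-S (σ i) (σ∈S i))

  on-path : ∀ i j h p → p ≤ suc (2 * K i j h) →
            At i j h p ∈ branch (nearer (K i j h) p i j) × depthOf (At i j h p) ≡ depth (K i j h) p
  on-path i j h zero _
    rewrite nearer-start (K i j h) i j | depth-start (K i j h) = root-in-branch i _ at-start
    where open IndexedOddPath (path i j h)
  on-path i j h (suc p) p≤ with m≤n⇒m<n∨m≡n p≤
  ... | inj₂ refl rewrite nearer-end (K i j h) i j | depth-end (K i j h) = root-in-branch j _ at-end
    where open IndexedOddPath (path i j h)
  ... | inj₁ (s≤s p<2k) = located∈branch _ L e , cong (maybe′ depthAt 0) e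
    where
    L : Location
    L = loc i j h (suc p)
    e : locate (At i j h (suc p)) ≡ just L
    e = locate-inner _ L (s≤s z≤n , p<2k , refl)

  owned-located : ∀ M i → T (ownedBy M i) → ∃ λ L → M ≡ just L × owner L ≡ i
  owned-located (just L) i owned = L , refl , toWitness owned

  root-unowned : ∀ i j → ¬ T (ownedBy (locate (σ i)) j)
  root-unowned i j = subst (λ M → ¬ T (ownedBy M j)) (≡-sym (locate-S (σ i) (σ∈S i))) (λ ())

  branch-inner : ∀ i x → x ∈ branch i → x ≢ σ i → ∃ λ L → locate x ≡ just L × owner L ≡ i
  branch-inner i x x∈ x≢σi with Equivalence.to (T-∨ {x == σ i}) x∈
  ... | inj₁ x≡σi = ⊥-elim (x≢σi (toWitness x≡σi))
  ... | inj₂ owned = owned-located (locate x) i owned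

  parent-step : ∀ i x → x ∈ branch i → x ≢ σ i →
                parent x ∈ branch i × Adj G x (parent x) × suc (depthOf (parent x)) ≡ depthOf x
  parent-step i x x∈ x≢σi with branch-inner i x x∈ x≢σi
  ... | loc a b h m , e , refl with locate-sound x _ e
  ...   | 1≤m , m≤2k , refl rewrite e =
    subst (λ o → At a b h p ∈ branch o) (nearer-towardEnd k a b m) (proj₁ p-facts) ,
    adjacent-towardEnd (path a b h) m 1≤m m≤2k ,
    trans (cong suc (proj₂ p-facts)) (depth-towardEnd k m 1≤m m≤2k)
    where
    k p : ℕ
    k = K a b h
    p = towardEnd k m
    p-facts : At a b h p ∈ branch (nearer k p a b) × depthOf (At a b h p) ≡ depth k p
    p-facts = on-path a b h p (towardEnd-bound k m m≤2k)

  module BranchTree (i : Fin t) =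
    ParentTree G (branch i) (σ i) parent depthOf (root∈branch i) (parent-step i)

  bichromatic : ∀ i x y → T (BranchTree.F i x y) → colour x ≢ colour y
  bichromatic i x y e same with BranchTree.edge-rank i e
  ... | inj₁ 1+dy≡dx = not-¬ refl (trans (≡-sym same) (cong isOdd (≡-sym 1+dy≡dx)))
  ... | inj₂ 1+dx≡dy = not-¬ refl (trans same (cong isOdd (≡-sym 1+dx≡dy)))

  branch-disjoint : ∀ i j → i ≢ j → ∀ x → x ∈ branch i → x ∉ branch j
  branch-disjoint i j i≢j x x∈i x∈j
    with Equivalence.to (T-∨ {x == σ i}) x∈i | Equivalence.to (T-∨ {x == σ j}) x∈j
  ... | inj₁ x≡σi | inj₁ x≡σj = i≢j (σ-inj i j (trans (≡-sym (toWitness x≡σi)) (toWitness x≡σj)))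
  ... | inj₁ x≡σi | inj₂ owned = root-unowned i j (subst (λ z → T (ownedBy (locate z) j)) (toWitness x≡σi) owned)
  ... | inj₂ owned | inj₁ x≡σj = root-unowned j i (subst (λ z → T (ownedBy (locate z) i)) (toWitness x≡σj) owned)
  ... | inj₂ ownedᵢ | inj₂ ownedⱼ with owned-located (locate x) i ownedᵢ | owned-located (locate x) j ownedⱼ
  ...   | L , e , refl | L′ , e′ , refl = i≢j (cong owner (just-injective (trans (≡-sym e) e′)))

  Joined : Fin t → Fin t → Set
  Joined i j = ∃[ x ] ∃[ y ] (x ∈ branch i × y ∈ branch j × Adj G x y × colour x ≡ colour y)

  -- The middle edge of the path of i < j joins branch i and branch j by two
  -- vertices of the same depth k, hence of the same colour.
  middle-edge : ∀ i j → i <ᶠ j → Joined i j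
  middle-edge i j h = At i j h k , At i j h (suc k) , x∈ , y∈ ,
                      IndexedOddPath.adjacent (path i j h) k (s≤s k≤2k) , cong isOdd (trans dx (≡-sym dy))
    where
    k : ℕ
    k = K i j h
    k≤2k : k ≤ 2 * k
    k≤2k = m≤m+n k (k + 0)
    x-facts : At i j h k ∈ branch (nearer k k i j) × depthOf (At i j h k) ≡ depth k k
    x-facts = on-path i j h k (m≤n⇒m≤1+n k≤2k)
    y-facts : At i j h (suc k) ∈ branch (nearer k (suc k) i j) × depthOf (At i j h (suc k)) ≡ depth k (suc k)
    y-facts = on-path i j h (suc k) (s≤s k≤2k)
    x∈ : At i j h k ∈ branch i
    x∈ = subst (λ o → At i j h k ∈ branch o) (proj₁ (nearer-middle k i j)) (proj₁ x-facts)
    y∈ : At i j h (suc k) ∈ branch j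
    y∈ = subst (λ o → At i j h (suc k) ∈ branch o) (proj₂ (nearer-middle k i j)) (proj₁ y-facts)
    dx : depthOf (At i j h k) ≡ k
    dx = trans (proj₂ x-facts) (proj₁ (depth-middle k))
    dy : depthOf (At i j h (suc k)) ≡ k
    dy = trans (proj₂ y-facts) (proj₂ (depth-middle k))

  joined : ∀ i j → i ≢ j → Joined i j
  joined i j i≢j with <ᶠ-cmp i j
  ... | tri< i<j _ _ = middle-edge i j i<j
  ... | tri≈ _ i≡j _ = ⊥-elim (i≢j i≡j)
  ... | tri> _ _ j<i with middle-edge j i j<i
  ...   | x , y , x∈ , y∈ , xy , same = y , x , y∈ , x∈ , adj-sym G xy , ≡-sym same

  minor : OddKMinor G t
  minor = record
    { tree = BranchTree.tree ; colour = colour ; disjoint = branch-disjoint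
    ; bichrom = bichromatic ; joined = joined }

lemma7p7 : (G : Graph) (S : VSet G) (t : ℕ) → count S ≡ t →
    (l : ℕ) (C : Fin l → VSet G) →
    (∀ i → IsComponentOfMinus G S (C i)) →
    (∀ i j → i ≢ j → ∀ x → x ∈ C i → x ∉ C j) →
    (∀ i s → s ∈ S → ∃[ x ] (x ∈ C i × Adj G s x)) →
    (∀ i u v → u ∈ S → v ∈ S → u ≢ v → OddPathVia G (C i) u v) →
    t * t ≤ 2 * l →
    OddKMinor G t
lemma7p7 G S t refl l C component disjoint _ oddPath bound =
  Construction.minor G S t elem elem∈ elem-inj l C avoids-S disjoint
    (pairCode t l bound) (pairCode-injective t l bound) path
  where
  open Enumeration (enumerate S)
  avoids-S : ∀ c x → x ∈ C c → x ∉ S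
  avoids-S c = proj₁ (proj₂ (component c))
  path : ∀ i j (h : i <ᶠ j) → IndexedOddPath G (C (pairCode t l bound i j h)) (elem i) (elem j)
  path i j h = index-odd-path G _ _ _
    (oddPath (pairCode t l bound i j h) (elem i) (elem j) (elem∈ i) (elem∈ j)
      (λ same → <-irrefl (cong toℕ (elem-inj i j same)) h))
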